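{- Let $k\ge2$ and let $\mathbf a=(a_1,\ldots,a_k)$ be a vector of positive integers with trace $\tau=\sum_j a_j$, and let $(A_n)_{n\ge1}$, $(B_n)_{n\ge1}$ be the associated anti-recurrence sequence and its complement. Suppose $\mathbf a$ is $A_1$-bounded, i.e. $A_1\le (k-1)\tau+2$. Put $\kappa=k\tau+1$ and $I_n=[\kappa(n-1)+1,\,\kappa n]$. Then $A_n\in I_n$ for all $n\ge1$, and for each $n$ the initial $B$-block of $I_n$ (the first $B$-block contained in $I_n$, which consists of its first $k$ elements) is an interval.
   Context: Anti-recurrence sequence: $(A_n)_{n\ge1}$ and $(B_n)_{n\ge1}$ are the unique strictly increasing sequences of positive integers that are complementary (every positive integer lies in exactly one of them) and satisfy $A_n=\sum_{j=1}^k a_jB_{(n-1)k+j}$ for all $n\ge1$. The $B$-blocks are the sets $\{B_{(m-1)k+1},\ldots,B_{mk}\}$, $m\ge1$. An interval $[a,b]$ is the set of consecutive integers $\{a,a+1,\ldots,b\}$. -}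

module Defs where

open import Data.Nat using (ℕ; zero; suc; _+_; _*_; _∸_; _≤_; _<_)
open import Data.Fin using (Fin; toℕ)
import Data.Fin as F
open import Data.Product using (Σ; ∃; _×_; _,_)
open import Data.Sum using (_⊎_)
open import Relation.Nullary using (¬_)
open import Relation.Binary.PropositionalEquality using (_≡_)
open import Function.Bundles using (_⇔_)

sumFin : (k : ℕ) → (Fin k → ℕ) → ℕ
sumFin zero    f = 0
sumFin (suc k) f = f F.zero + sumFin k (λ j → f (F.suc j))

-- Trace τ = Σ_j a_j  (the vector a = (a_1..a_k) is a : Fin k → ℕ, a_{j+1} = a j).
trace : (k : ℕ) → (Fin k → ℕ) → ℕ
trace k a = sumFin k a

-- Sequences are ℕ → ℕ indexed from 1 (the value at index 0 is irrelevant).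
StrictlyIncreasingPos : (ℕ → ℕ) → Set
StrictlyIncreasingPos S = (∀ n → 1 ≤ n → 1 ≤ S n) × (∀ n → 1 ≤ n → S n < S (suc n))

InSeq : (ℕ → ℕ) → ℕ → Set
InSeq S x = Σ ℕ λ n → 1 ≤ n × S n ≡ x

Complementary : (ℕ → ℕ) → (ℕ → ℕ) → Set
Complementary A B = ∀ x → 1 ≤ x → (InSeq A x ⊎ InSeq B x) × ¬ (InSeq A x × InSeq B x)

IsAntiRecurrence : (k : ℕ) → (Fin k → ℕ) → (ℕ → ℕ) → (ℕ → ℕ) → Set
IsAntiRecurrence k a A B =
  StrictlyIncreasingPos A × StrictlyIncreasingPos B × Complementary A B ×
  (∀ n → 1 ≤ n → A n ≡ sumFin k (λ j → a j * B ((n ∸ 1) * k + suc (toℕ j))))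

InBlock : (k : ℕ) → (ℕ → ℕ) → ℕ → ℕ → Set
InBlock k B m x = Σ ℕ λ j → 1 ≤ j × j ≤ k × B ((m ∸ 1) * k + j) ≡ x

InInterval : ℕ → ℕ → ℕ → Set
InInterval lo hi x = lo ≤ x × x ≤ hi

IsInterval : (ℕ → Set) → Set
IsInterval P = Σ ℕ λ lo → Σ ℕ λ hi → ∀ x → P x ⇔ InInterval lo hi x

BlockContained : (k : ℕ) → (ℕ → ℕ) → ℕ → ℕ → ℕ → Set
BlockContained k B m lo hi = ∀ x → InBlock k B m x → InInterval lo hi x

{-# OPTIONS --safe #-}
-- Cut the positive integers into the windows I (M + 1) = [κM + 1, κM + κ], κ = kτ + 1, K = kτ.
-- By strong induction on M, A (M + 1) = κM + o_M with an offset k < o_M ≤ κ.  Given the offsets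
-- o_0, …, o_Q, the B-values of I (Q + 1) are B (QK + s) = κQ + (the s-th positive integer other
-- than o_Q), 1 ≤ s ≤ K.  Writing M + 1 = Qτ + R with R < τ, the B-block defining A (M + 2) thus
-- occupies the places Rk + 1, …, Rk + k of I (Q + 1), whence A (M + 2) = κ(M + 1) + A₁ + E − R,
-- where E ≤ τ sums the weights a_j whose place lies beyond o_Q; A₁-boundedness keeps this offset
-- at most κ.  Finally the block Nτ + 1 fills the first k places of I (N + 1), which precede o_N.
module Submission where

open import Defs
open import Data.Nat using (ℕ; zero; suc; _+_; _*_; _∸_; _≤_; _<_; z≤n; s≤s; NonZero; >-nonZero; _≤?_; _<?_)
open import Data.Fin using (Fin; toℕ) renaming (zero to fzero; suc to fsuc)
open import Data.Product using (Σ; _×_; _,_; proj₁; proj₂)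
open import Relation.Nullary using (¬_; yes; no; contradiction)
open import Data.Nat.Properties
open import Data.Nat.DivMod using (_/_; _%_; m≡m%n+[m/n]*n; m%n<n; m/n<m)
open import Data.Nat.Induction using (<-rec)
open import Data.Nat.Tactic.RingSolver using (solve-∀)
open import Algebra.Properties.CommutativeSemigroup +-commutativeSemigroup
  using () renaming (interchange to +-interchange; xy∙z≈xz∙y to +-rightComm)
open import Data.Fin.Properties using (toℕ<n)
open import Data.Sum using (inj₁; inj₂)
open import Function.Base using (_∘_)
open import Function.Bundles using (_⇔_; mk⇔; Equivalence)
open import Relation.Binary.Definitions using (tri<; tri≈; tri>)
open import Relation.Binary.PropositionalEquality

sumFin-cong : ∀ k {f g : Fin k → ℕ} → (∀ j → f j ≡ g j) → sumFin k f ≡ sumFin k g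
sumFin-cong zero    f≗g = refl
sumFin-cong (suc k) f≗g = cong₂ _+_ (f≗g fzero) (sumFin-cong k (f≗g ∘ fsuc))

sumFin-mono : ∀ k {f g : Fin k → ℕ} → (∀ j → f j ≤ g j) → sumFin k f ≤ sumFin k g
sumFin-mono zero    f≤g = z≤n
sumFin-mono (suc k) f≤g = +-mono-≤ (f≤g fzero) (sumFin-mono k (f≤g ∘ fsuc))

sumFin-+ : ∀ k (f g : Fin k → ℕ) → sumFin k (λ j → f j + g j) ≡ sumFin k f + sumFin k g
sumFin-+ zero    f g = refl
sumFin-+ (suc k) f g =
  trans (cong (f fzero + g fzero +_) (sumFin-+ k (f ∘ fsuc) (g ∘ fsuc)))
        (+-interchange (f fzero) (g fzero) (sumFin k (f ∘ fsuc)) (sumFin k (g ∘ fsuc)))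

sumFin-*ʳ : ∀ k (f : Fin k → ℕ) c → sumFin k (λ j → f j * c) ≡ sumFin k f * c
sumFin-*ʳ zero    f c = refl
sumFin-*ʳ (suc k) f c =
  trans (cong (f fzero * c +_) (sumFin-*ʳ k (f ∘ fsuc) c)) (sym (*-distribʳ-+ c (f fzero) _))

k≤sumFin : ∀ k {f : Fin k → ℕ} → (∀ j → 1 ≤ f j) → k ≤ sumFin k f
k≤sumFin zero    1≤f = z≤n
k≤sumFin (suc k) 1≤f = +-mono-≤ (1≤f fzero) (k≤sumFin k (1≤f ∘ fsuc))

x≤w*x : ∀ {w} x → 1 ≤ w → x ≤ w * x
x≤w*x x 1≤w = m≤n*m x _ {{>-nonZero 1≤w}}

sumFin-last : ∀ k (w : Fin k → ℕ) (g : ℕ → ℕ) → (∀ j → 1 ≤ w j) → 1 ≤ k →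
              g k ≤ sumFin k (λ j → w j * g (suc (toℕ j)))
sumFin-last (suc zero)    w g 1≤w _ = ≤-trans (x≤w*x (g 1) (1≤w fzero)) (m≤m+n _ 0)
sumFin-last (suc (suc k)) w g 1≤w _ =
  ≤-trans (sumFin-last (suc k) (w ∘ fsuc) (g ∘ suc) (1≤w ∘ fsuc) (s≤s z≤n)) (m≤n+m _ (w fzero * g 1))

sumFin-first+last : ∀ k (w : Fin k → ℕ) (g : ℕ → ℕ) → (∀ j → 1 ≤ w j) → 2 ≤ k →
                    g 1 + g k ≤ sumFin k (λ j → w j * g (suc (toℕ j)))
sumFin-first+last (suc zero)    w g 1≤w (s≤s ())
sumFin-first+last (suc (suc k)) w g 1≤w _ =
  +-mono-≤ (x≤w*x (g 1) (1≤w fzero))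
           (sumFin-last (suc k) (w ∘ fsuc) (g ∘ suc) (1≤w ∘ fsuc) (s≤s z≤n))

*-+-< : ∀ c {M Q x y} → M < Q → x < c + y → c * M + x < c * Q + y
*-+-< c {M} {Q} {x} {y} M<Q x<c+y = begin-strict
  c * M + x         <⟨ +-monoʳ-< (c * M) x<c+y ⟩
  c * M + (c + y)   ≡⟨ regroup c M y ⟩
  c * suc M + y     ≤⟨ +-monoˡ-≤ y (*-monoʳ-≤ c M<Q) ⟩
  c * Q + y         ∎
  where
  open ≤-Reasoning
  regroup : ∀ c M y → c * M + (c + y) ≡ c * suc M + y
  regroup = solve-∀

quotient-unique : ∀ c {M Q x y} → c * M + x ≡ c * Q + y → x < c + y → y < c + x → M ≡ Q
quotient-unique c {M} {Q} eq x<c+y y<c+x with <-cmp M Q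
... | tri< M<Q _ _ = contradiction eq (<⇒≢ (*-+-< c M<Q x<c+y))
... | tri≈ _ M≡Q _ = M≡Q
... | tri> _ _ Q<M = contradiction (sym eq) (<⇒≢ (*-+-< c Q<M y<c+x))

[k∸1]*τ+τ≡k*τ : ∀ {k} τ → 1 ≤ k → (k ∸ 1) * τ + τ ≡ k * τ
[k∸1]*τ+τ≡k*τ {suc k} τ _ = +-comm (k * τ) τ

τ+k+τ≤2+k*τ : ∀ {k τ} → 2 ≤ k → 1 ≤ τ → τ + k + τ ≤ 2 + k * τ
τ+k+τ≤2+k*τ {suc zero}    {suc τ} (s≤s ()) _
τ+k+τ≤2+k*τ {suc (suc k)} {suc τ} _ _ = begin
  suc τ + suc (suc k) + suc τ                ≤⟨ m≤m+n _ (k * τ) ⟩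
  suc τ + suc (suc k) + suc τ + k * τ        ≡⟨ expand k τ ⟩
  2 + suc (suc k) * suc τ                    ∎
  where
  open ≤-Reasoning
  expand : ∀ k τ → suc τ + suc (suc k) + suc τ + k * τ ≡ 2 + suc (suc k) * suc τ
  expand = solve-∀

⟦_≤_⟧ : ℕ → ℕ → ℕ
⟦ o ≤ s ⟧ with o ≤? s
... | yes _ = 1
... | no  _ = 0

⟦≤⟧-yes : ∀ {o s} → o ≤ s → ⟦ o ≤ s ⟧ ≡ 1
⟦≤⟧-yes {o} {s} o≤s with o ≤? s
... | yes _   = refl
... | no  o≰s = contradiction o≤s o≰s

⟦≤⟧-no : ∀ {o s} → s < o → ⟦ o ≤ s ⟧ ≡ 0
⟦≤⟧-no {o} {s} s<o with o ≤? s
... | yes o≤s = contradiction o≤s (<⇒≱ s<o)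
... | no  _   = refl

⟦≤⟧≤1 : ∀ o s → ⟦ o ≤ s ⟧ ≤ 1
⟦≤⟧≤1 o s with o ≤? s
... | yes _ = ≤-refl
... | no  _ = z≤n

-- The s-th positive integer other than o: the ℕ-analogue of Data.Fin.punchIn.
punchIn : ℕ → ℕ → ℕ
punchIn o s = s + ⟦ o ≤ s ⟧

punchIn-< : ∀ {o s} → s < o → punchIn o s ≡ s
punchIn-< {o} {s} s<o = trans (cong (s +_) (⟦≤⟧-no s<o)) (+-identityʳ s)

punchIn-≥ : ∀ {o s} → o ≤ s → punchIn o s ≡ suc s
punchIn-≥ {o} {s} o≤s = trans (cong (s +_) (⟦≤⟧-yes o≤s)) (+-comm s 1)

punchIn-≤ : ∀ o s → punchIn o s ≤ suc s
punchIn-≤ o s = subst (punchIn o s ≤_) (+-comm s 1) (+-monoʳ-≤ s (⟦≤⟧≤1 o s))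

punchIn≢ : ∀ o s → punchIn o s ≢ o
punchIn≢ o s eq with <-cmp s o
... | tri< s<o _ _ = <⇒≢ s<o (trans (sym (punchIn-< s<o)) eq)
... | tri≈ _ refl _ = <⇒≢ (n<1+n s) (sym (trans (sym (punchIn-≥ ≤-refl)) eq))
... | tri> _ _ o<s = <⇒≢ (<-trans o<s (n<1+n s)) (sym (trans (sym (punchIn-≥ (<⇒≤ o<s))) eq))

punchIn-<-suc : ∀ o s → punchIn o s < punchIn o (suc s)
punchIn-<-suc o s with <-cmp o (suc s)
... | tri< o<ss _ _ rewrite punchIn-≥ (≤-pred o<ss) | punchIn-≥ (<⇒≤ o<ss) = n<1+n (suc s)
... | tri≈ _ refl _ rewrite punchIn-< (n<1+n s) | punchIn-≥ (≤-refl {suc s}) =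
  <-trans (n<1+n s) (n<1+n (suc s))
... | tri> _ _ ss<o rewrite punchIn-< (<-trans (n<1+n s) ss<o) | punchIn-< ss<o = n<1+n s

punchIn-gap : ∀ {o s t} → punchIn o s < t → t < punchIn o (suc s) → t ≡ o
punchIn-gap {o} {s} {t} l u with <-cmp o (suc s)
... | tri< o<ss _ _ rewrite punchIn-≥ (≤-pred o<ss) | punchIn-≥ (<⇒≤ o<ss) =
  contradiction (≤-pred u) (<⇒≱ l)
... | tri≈ _ refl _ rewrite punchIn-< (n<1+n s) | punchIn-≥ (≤-refl {suc s}) =
  ≤-antisym (≤-pred u) l
... | tri> _ _ ss<o rewrite punchIn-< (<-trans (n<1+n s) ss<o) | punchIn-< ss<o =
  contradiction (≤-pred u) (<⇒≱ l)

module StrictlyIncreasing {S : ℕ → ℕ} (S↑ : StrictlyIncreasingPos S) where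

  strictMono-< : ∀ {i j} → 1 ≤ i → i < j → S i < S j
  strictMono-< {i} {suc j} 1≤i (s≤s i≤j) with m≤n⇒m<n∨m≡n i≤j
  ... | inj₁ i<j  = <-trans (strictMono-< 1≤i i<j) (proj₂ S↑ j (≤-trans 1≤i (<⇒≤ i<j)))
  ... | inj₂ refl = proj₂ S↑ i 1≤i

  strictMono-≤ : ∀ {i j} → 1 ≤ i → i ≤ j → S i ≤ S j
  strictMono-≤ 1≤i i≤j with m≤n⇒m<n∨m≡n i≤j
  ... | inj₁ i<j  = <⇒≤ (strictMono-< 1≤i i<j)
  ... | inj₂ refl = ≤-refl

  strictMono-cancel-< : ∀ {i j} → 1 ≤ j → S i < S j → i < j
  strictMono-cancel-< 1≤j Si<Sj = ≰⇒> (λ j≤i → <⇒≱ Si<Sj (strictMono-≤ 1≤j j≤i))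

module ComplementaryPair {A B : ℕ → ℕ} (A↑ : StrictlyIncreasingPos A) (B↑ : StrictlyIncreasingPos B)
                         (A⊎B : Complementary A B) where

  open StrictlyIncreasing B↑

  not-both : ∀ {x} → InSeq A x → ¬ InSeq B x
  not-both x∈A@(n , 1≤n , An≡x) x∈B =
    proj₂ (A⊎B _ (subst (1 ≤_) An≡x (proj₁ A↑ n 1≤n))) (x∈A , x∈B)

  B-of-not-A : ∀ {x} → 1 ≤ x → ¬ InSeq A x → InSeq B x
  B-of-not-A 1≤x x∉A with proj₁ (A⊎B _ 1≤x)
  ... | inj₁ x∈A = contradiction x∈A x∉A
  ... | inj₂ x∈B = x∈B

  B₁≡1 : ¬ InSeq A 1 → B 1 ≡ 1
  B₁≡1 1∉A with B-of-not-A ≤-refl 1∉A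
  ... | l , 1≤l , Bl≡1 = ≤-antisym (subst (B 1 ≤_) Bl≡1 (strictMono-≤ ≤-refl 1≤l)) (proj₁ B↑ 1 ≤-refl)

  B-suc≡ : ∀ {i y z} → 1 ≤ i → B i ≡ y → y < z → (∀ w → y < w → w < z → InSeq A w) →
           (z ≤ B (suc i) → ¬ InSeq A z) → B (suc i) ≡ z
  B-suc≡ {i} {y} {z} 1≤i B≡ y<z gap z∉A = ≤-antisym Bsi≤z z≤Bsi
    where
    y<Bsi : y < B (suc i)
    y<Bsi = subst (_< B (suc i)) B≡ (proj₂ B↑ i 1≤i)
    z≤Bsi : z ≤ B (suc i)
    z≤Bsi = ≮⇒≥ (λ Bsi<z → not-both (gap _ y<Bsi Bsi<z) (suc i , s≤s z≤n , refl))
    Bsi≤z : B (suc i) ≤ z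
    Bsi≤z with B-of-not-A (≤-trans (s≤s z≤n) y<z) (z∉A z≤Bsi)
    ... | l , 1≤l , Bl≡z = subst (B (suc i) ≤_) Bl≡z (strictMono-≤ (s≤s z≤n) si≤l)
      where
      si≤l : suc i ≤ l
      si≤l = ≮⇒≥ (λ l<si → <⇒≱ (subst (y <_) (sym Bl≡z) y<z)
                                 (subst (B l ≤_) B≡ (strictMono-≤ 1≤l (≤-pred l<si))))

module Blocks (k : ℕ) {B : ℕ → ℕ} (B↑ : StrictlyIncreasingPos B) where

  open StrictlyIncreasing B↑

  block-isInterval : ∀ m c → (∀ j → 1 ≤ j → j ≤ k → B ((m ∸ 1) * k + j) ≡ c + j) →
                     ∀ x → InBlock k B m x ⇔ InInterval (c + 1) (c + k) x
  block-isInterval m c B≡ x = mk⇔ to from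
    where
    to : InBlock k B m x → InInterval (c + 1) (c + k) x
    to (j , 1≤j , j≤k , Bj≡x) =
      subst (InInterval (c + 1) (c + k)) (trans (sym (B≡ j 1≤j j≤k)) Bj≡x)
            (+-monoʳ-≤ c 1≤j , +-monoʳ-≤ c j≤k)
    from : InInterval (c + 1) (c + k) x → InBlock k B m x
    from (lo , hi) = x ∸ c , 1≤j , j≤k , trans (B≡ (x ∸ c) 1≤j j≤k) c+j≡x
      where
      c+j≡x : c + (x ∸ c) ≡ x
      c+j≡x = m+[n∸m]≡n (≤-trans (m≤m+n c 1) lo)
      1≤j : 1 ≤ x ∸ c
      1≤j = +-cancelˡ-≤ c _ _ (subst (c + 1 ≤_) (sym c+j≡x) lo)
      j≤k : x ∸ c ≤ k
      j≤k = +-cancelˡ-≤ c _ _ (subst (_≤ c + k) (sym c+j≡x) hi)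

  earlier-block-not-contained : 1 ≤ k → ∀ m {lo hi} → B ((m ∸ 1) * k + 1) ≡ lo →
                                ∀ m′ → 1 ≤ m′ → m′ < m → ¬ BlockContained k B m′ lo hi
  earlier-block-not-contained 1≤k (suc m) first≡lo (suc m′) _ (s≤s m′<m) contained =
    <⇒≱ (subst (B (m′ * k + 1) <_) first≡lo earlier<first)
        (proj₁ (contained _ (1 , ≤-refl , 1≤k , refl)))
    where
    earlier<first : B (m′ * k + 1) < B (m * k + 1)
    earlier<first = strictMono-< (m≤n+m 1 _) (+-monoˡ-< 1 (*-monoˡ-< k {{>-nonZero 1≤k}} m′<m))

module AntiRecurrence (k : ℕ) (2≤k : 2 ≤ k) (a : Fin k → ℕ) (1≤a : ∀ j → 1 ≤ a j)
                      (A B : ℕ → ℕ) (AR : IsAntiRecurrence k a A B)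
                      (A₁-bounded : A 1 ≤ (k ∸ 1) * trace k a + 2) where

  A↑ : StrictlyIncreasingPos A
  A↑ = proj₁ AR

  B↑ : StrictlyIncreasingPos B
  B↑ = proj₁ (proj₂ AR)

  A≡sum : ∀ n → 1 ≤ n → A n ≡ sumFin k (λ j → a j * B ((n ∸ 1) * k + suc (toℕ j)))
  A≡sum = proj₂ (proj₂ (proj₂ AR))

  open ComplementaryPair A↑ B↑ (proj₁ (proj₂ (proj₂ AR)))
  open StrictlyIncreasing using (strictMono-≤; strictMono-cancel-<)

  τ K κ P : ℕ
  τ = trace k a
  K = k * τ
  κ = K + 1
  P = sumFin k (λ j → a j * suc (toℕ j))

  1≤k : 1 ≤ k
  1≤k = <⇒≤ 2≤k

  k≤τ : k ≤ τ
  k≤τ = k≤sumFin k 1≤a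

  instance
    τ-nonZero : NonZero τ
    τ-nonZero = >-nonZero (≤-trans 1≤k k≤τ)

  k≤K : k ≤ K
  k≤K = m≤m*n k τ

  1≤K : 1 ≤ K
  1≤K = ≤-trans 1≤k k≤K

  κ≡suc-K : κ ≡ suc K
  κ≡suc-K = +-comm K 1

  suc≤κ : ∀ {s} → s ≤ K → suc s ≤ κ
  suc≤κ {s} s≤K = subst (suc s ≤_) (sym κ≡suc-K) (s≤s s≤K)

  k≤κ : k ≤ κ
  k≤κ = ≤-trans k≤K (m≤m+n K 1)

  κ*N+≤κ*sucN : ∀ N {x} → x ≤ κ → κ * N + x ≤ κ * suc N
  κ*N+≤κ*sucN N x≤κ =
    ≤-trans (+-monoʳ-≤ (κ * N) x≤κ) (≤-reflexive (trans (+-comm (κ * N) κ) (sym (*-suc κ N))))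

  P-split : P ≡ τ + sumFin k (λ j → a j * toℕ j)
  P-split = trans (sumFin-cong k (λ j → *-suc (a j) (toℕ j))) (sumFin-+ k a _)

  τ≤P : τ ≤ P
  τ≤P = subst (τ ≤_) (sym P-split) (m≤m+n τ _)

  τ+k≤sucP : τ + k ≤ suc P
  τ+k≤sucP = begin
    τ + k                                  ≤⟨ +-monoʳ-≤ τ (m≤n+m∸n k 1) ⟩
    τ + suc (k ∸ 1)                        ≤⟨ +-monoʳ-≤ τ (s≤s (sumFin-last k a (_∸ 1) 1≤a 1≤k)) ⟩
    τ + suc (sumFin k (λ j → a j * toℕ j)) ≡⟨ +-suc τ _ ⟩
    suc (τ + sumFin k (λ j → a j * toℕ j)) ≡⟨ cong suc (sym P-split) ⟩
    suc P                                  ∎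
    where open ≤-Reasoning

  k<P : k < P
  k<P = ≤-pred (≤-trans (+-monoˡ-≤ k 2≤k) (≤-trans (+-monoˡ-≤ k k≤τ) τ+k≤sucP))

  P≤K : P ≤ K
  P≤K = begin
    P                                ≤⟨ sumFin-mono k (λ j → *-monoʳ-≤ (a j) (toℕ<n j)) ⟩
    sumFin k (λ j → a j * k)         ≡⟨ sumFin-*ʳ k a k ⟩
    τ * k                            ≡⟨ *-comm τ k ⟩
    K                                ∎
    where open ≤-Reasoning

  B-last<A : ∀ N → B (suc N * k) < A (suc N)
  B-last<A N = begin-strict
    B (suc N * k)                       ≡⟨ cong B (+-comm k (N * k)) ⟩
    B (N * k + k)                       <⟨ m<n+m _ (proj₁ B↑ (N * k + 1) (m≤n+m 1 _)) ⟩
    B (N * k + 1) + B (N * k + k)       ≤⟨ sumFin-first+last k a (λ t → B (N * k + t)) 1≤a 2≤k ⟩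
    sumFin k (λ j → a j * B (N * k + suc (toℕ j))) ≡⟨ sym (A≡sum (suc N) (s≤s z≤n)) ⟩
    A (suc N)                           ∎
    where open ≤-Reasoning

  A-index-bound : ∀ {Nb m i} → 1 ≤ i → i ≤ suc Nb * k → A m ≤ B i → m ≤ Nb
  A-index-bound {Nb} {m} {i} 1≤i i≤ Am≤Bi = ≤-pred (strictMono-cancel-< A↑ (s≤s z≤n) (begin-strict
    A m             ≤⟨ Am≤Bi ⟩
    B i             ≤⟨ strictMono-≤ B↑ 1≤i i≤ ⟩
    B (suc Nb * k)  <⟨ B-last<A Nb ⟩
    A (suc Nb)      ∎))
    where open ≤-Reasoning

  not-A-below-first-block : ∀ {z i} → 1 ≤ i → i ≤ k → z ≤ B i → ¬ InSeq A z
  not-A-below-first-block {i = i} 1≤i i≤k z≤Bi (m , 1≤m , Am≡z) = <⇒≱ 1≤m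
    (A-index-bound {0} 1≤i (subst (i ≤_) (sym (*-identityˡ k)) i≤k) (subst (_≤ B i) (sym Am≡z) z≤Bi))

  B-initial : ∀ s → 1 ≤ s → s ≤ k → B s ≡ s
  B-initial (suc zero)    _ _    = B₁≡1 (not-A-below-first-block ≤-refl 1≤k (proj₁ B↑ 1 ≤-refl))
  B-initial (suc (suc s)) _ ss≤k =
    B-suc≡ (s≤s z≤n) (B-initial (suc s) (s≤s z≤n) (<⇒≤ ss≤k)) ≤-refl
      (λ w s<w w<ss → contradiction (≤-pred w<ss) (<⇒≱ s<w))
      (not-A-below-first-block (s≤s z≤n) ss≤k)

  A₁≡P : A 1 ≡ P
  A₁≡P = trans (A≡sum 1 ≤-refl)
    (sumFin-cong k (λ j → cong (a j *_) (B-initial (suc (toℕ j)) (s≤s z≤n) (toℕ<n j))))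

  offset : ℕ → ℕ
  offset M = A (suc M) ∸ κ * M

  record Admissible (p : ℕ) : Set where
    field
      lower : k < p
      upper : p ≤ κ
      -- Needed only when A₁ = τ + k − 1, its least possible value, to keep the next offset above k.
      short : P < τ + k → p ≤ K

    1<p : 1 < p
    1<p = <-trans 2≤k lower

  record Placed (M : ℕ) : Set where
    field
      A-suc≡ : A (suc M) ≡ κ * M + offset M
      admissible : Admissible (offset M)

  placed : ∀ {M p} → A (suc M) ≡ κ * M + p → Admissible p → Placed M
  placed {M} {p} A≡ adm = record
    { A-suc≡ = trans A≡ (cong (κ * M +_) (sym offset≡p))
    ; admissible = subst Admissible (sym offset≡p) adm
    }
    where
    offset≡p : offset M ≡ p
    offset≡p = trans (cong (_∸ κ * M) A≡) (m+n∸m≡n (κ * M) p)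

  P-admissible : Admissible P
  P-admissible = record
    { lower = k<P ; upper = ≤-trans P≤K (m≤m+n K 1) ; short = λ _ → P≤K }

  placed-zero : Placed 0
  placed-zero = placed (trans A₁≡P (cong (_+ P) (sym (*-zeroʳ κ)))) P-admissible

  P+τ≤K+2 : P + τ ≤ K + 2
  P+τ≤K+2 = begin
    P + τ                ≤⟨ +-monoˡ-≤ τ (subst (_≤ (k ∸ 1) * τ + 2) A₁≡P A₁-bounded) ⟩
    (k ∸ 1) * τ + 2 + τ  ≡⟨ +-rightComm ((k ∸ 1) * τ) 2 τ ⟩
    (k ∸ 1) * τ + τ + 2  ≡⟨ cong (_+ 2) ([k∸1]*τ+τ≡k*τ τ 1≤k) ⟩
    K + 2                ∎
    where open ≤-Reasoning

  next-offset-admissible : ∀ R {E p} → R < τ → R + p ≡ P + E → E ≤ τ → (R ≡ 0 → E ≡ 0) →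
                           (suc R ≡ τ → P < τ + k → 1 ≤ E) → Admissible p
  next-offset-admissible zero {E} {p} _ p≡P+E _ E≡0 _ = subst Admissible (sym p≡P) P-admissible
    where
    p≡P : p ≡ P
    p≡P = trans p≡P+E (trans (cong (P +_) (E≡0 refl)) (+-identityʳ P))
  next-offset-admissible (suc R) {E} {p} r<τ r+p≡P+E E≤τ _ 1≤E = record
    { lower = +-cancelˡ-≤ r _ _ (begin
        r + suc k  ≡⟨ +-suc r k ⟩
        suc r + k  ≤⟨ sucr+k≤P+E ⟩
        P + E      ≡⟨ sym r+p≡P+E ⟩
        r + p      ∎)
    ; upper = +-cancelˡ-≤ r _ _ (begin
        r + p      ≡⟨ r+p≡P+E ⟩
        P + E      ≤⟨ +-monoʳ-≤ P E≤τ ⟩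
        P + τ      ≤⟨ P+τ≤K+2 ⟩
        K + 2      ≡⟨ +-suc K 1 ⟩
        1 + κ      ≤⟨ +-monoˡ-≤ κ {1} {r} (s≤s z≤n) ⟩
        r + κ      ∎)
    ; short = λ P<τ+k → +-cancelˡ-≤ 2 _ _ (begin
        2 + p      ≤⟨ +-monoˡ-≤ p (s≤s (s≤s z≤n)) ⟩
        suc r + p  ≡⟨ cong suc r+p≡P+E ⟩
        suc P + E  ≤⟨ +-mono-≤ P<τ+k E≤τ ⟩
        τ + k + τ  ≤⟨ τ+k+τ≤2+k*τ 2≤k (≤-trans 1≤k k≤τ) ⟩
        2 + K      ∎)
    }
    where
    open ≤-Reasoning
    r = suc R
    sucr+k≤P+E : suc r + k ≤ P + E
    sucr+k≤P+E with τ + k ≤? P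
    ... | yes τ+k≤P = ≤-trans (+-monoˡ-≤ k r<τ) (≤-trans τ+k≤P (m≤m+n P E))
    ... | no  τ+k≰P with suc r <? τ
    ...   | yes sr<τ = ≤-trans (≤-pred (subst (suc r + k <_) τ+k≡sucP (+-monoˡ-< k sr<τ))) (m≤m+n P E)
      where
      τ+k≡sucP : τ + k ≡ suc P
      τ+k≡sucP = ≤-antisym τ+k≤sucP (≰⇒> τ+k≰P)
    ...   | no  sr≮τ = begin
        suc r + k  ≡⟨ cong (_+ k) sr≡τ ⟩
        τ + k      ≤⟨ τ+k≤sucP ⟩
        suc P      ≡⟨ +-comm 1 P ⟩
        P + 1      ≤⟨ +-monoʳ-≤ P (1≤E sr≡τ (≰⇒> τ+k≰P)) ⟩
        P + E      ∎
      where
      sr≡τ : suc r ≡ τ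
      sr≡τ = ≤-antisym r<τ (≮⇒≥ sr≮τ)

  -- All B-values of index ≤ (Nb + 1)k lie below A (Nb + 1) (B-last<A), so placing A 1, …, A Nb
  -- determines them.
  module KnownOffsets {Nb} (known : ∀ {M} → M < Nb → Placed M) where

    offset-in-window : ∀ {m i Q r} → 1 ≤ m → 1 ≤ i → i ≤ suc Nb * k → A m ≤ B i →
                       A m ≡ κ * Q + r → 1 ≤ r → r ≤ suc κ → offset Q ≡ r
    offset-in-window {suc M} {_} {Q} {r} _ 1≤i i≤ Am≤Bi Am≡ 1≤r r≤ = begin
      offset Q  ≡⟨ cong offset (sym M≡Q) ⟩
      offset M  ≡⟨ +-cancelˡ-≡ (κ * M) _ _ (trans (sym A-suc≡) (subst (λ q → A (suc M) ≡ κ * q + r) (sym M≡Q) Am≡))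
                 ⟩
      r         ∎
      where
      open ≡-Reasoning
      open Placed (known (A-index-bound 1≤i i≤ Am≤Bi))
      open Admissible admissible
      -- Admitting r = κ + 1, i.e. the point κ(Q + 1) + 1, is sound because every offset exceeds 1.
      M≡Q : M ≡ Q
      M≡Q = quotient-unique κ (trans (sym A-suc≡) Am≡)
              (≤-<-trans upper (m<m+n κ 1≤r))
              (≤-<-trans r≤ (subst (_< κ + offset M) (+-comm κ 1) (+-monoʳ-< κ 1<p)))

    B-in-interval-suc : ∀ {Q s} → Q < Nb → 1 ≤ s → s ≤ K → Q * K + suc s ≤ suc Nb * k →
                        B (Q * K + s) ≡ κ * Q + punchIn (offset Q) s →
                        B (Q * K + suc s) ≡ κ * Q + punchIn (offset Q) (suc s)
    B-in-interval-suc {Q} {s} Q<Nb 1≤s s≤K idx B≡ =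
      subst (λ i → B i ≡ z) (sym (+-suc (Q * K) s))
        (B-suc≡ (≤-trans 1≤s (m≤n+m s (Q * K))) B≡ (+-monoʳ-< (κ * Q) (punchIn-<-suc o s)) gap z∉A)
      where
      open Placed (known Q<Nb)
      o = offset Q
      z = κ * Q + punchIn o (suc s)
      gap : ∀ w → κ * Q + punchIn o s < w → w < z → InSeq A w
      gap w y<w w<z = suc Q , s≤s z≤n , trans A-suc≡ (trans (cong (κ * Q +_) (sym t≡o)) κQ+t≡w)
        where
        κQ+t≡w : κ * Q + (w ∸ κ * Q) ≡ w
        κQ+t≡w = m+[n∸m]≡n (≤-trans (m≤m+n (κ * Q) _) (<⇒≤ y<w))
        t≡o : w ∸ κ * Q ≡ o
        t≡o = punchIn-gap (+-cancelˡ-< (κ * Q) _ _ (subst (_ <_) (sym κQ+t≡w) y<w))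
                          (+-cancelˡ-< (κ * Q) _ _ (subst (_< z) (sym κQ+t≡w) w<z))
      z∉A : z ≤ B (suc (Q * K + s)) → ¬ InSeq A z
      z∉A z≤B (m , 1≤m , Am≡z) = punchIn≢ o (suc s) (sym (offset-in-window 1≤m (s≤s z≤n)
        (subst (_≤ suc Nb * k) (+-suc (Q * K) s) idx)
        (subst (_≤ B (suc (Q * K + s))) (sym Am≡z) z≤B) Am≡z
        (≤-trans (s≤s z≤n) (m≤m+n (suc s) _))
        (≤-trans (punchIn-≤ o (suc s)) (s≤s (suc≤κ s≤K)))))

    B-interval-start : ∀ {Q} → Q < Nb → Q * K + 1 ≤ suc Nb * k → B (Q * K + 1) ≡ κ * Q + 1
    B-in-interval : ∀ {Q s} → Q < Nb → 1 ≤ s → s ≤ K → Q * K + s ≤ suc Nb * k →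
                    B (Q * K + s) ≡ κ * Q + punchIn (offset Q) s

    B-interval-start {zero}  _    _   = trans (B-initial 1 ≤-refl 1≤k) (cong (_+ 1) (sym (*-zeroʳ κ)))
    B-interval-start {suc Q} Q<Nb idx = begin
      B (suc Q * K + 1)                   ≡⟨ cong B (index Q K) ⟩
      B (Q * K + suc K)                   ≡⟨ B-in-interval-suc Q<Nb′ 1≤K ≤-refl idx′ last-of-previous ⟩
      κ * Q + punchIn (offset Q) (suc K)  ≡⟨ cong (κ * Q +_) (punchIn-≥ (subst (offset Q ≤_) κ≡suc-K upper)) ⟩
      κ * Q + suc (suc K)                 ≡⟨ next-interval Q K ⟩
      κ * suc Q + 1                       ∎
      where
      open ≡-Reasoning
      Q<Nb′ : Q < Nb
      Q<Nb′ = <-trans (n<1+n Q) Q<Nb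
      open Admissible (Placed.admissible (known Q<Nb′))
      index : ∀ Q K → suc Q * K + 1 ≡ Q * K + suc K
      index = solve-∀
      next-interval : ∀ Q K → (K + 1) * Q + suc (suc K) ≡ (K + 1) * suc Q + 1
      next-interval = solve-∀
      idx′ : Q * K + suc K ≤ suc Nb * k
      idx′ = subst (_≤ suc Nb * k) (index Q K) idx
      last-of-previous : B (Q * K + K) ≡ κ * Q + punchIn (offset Q) K
      last-of-previous = B-in-interval Q<Nb′ 1≤K ≤-refl (≤-trans (+-monoʳ-≤ (Q * K) (n≤1+n K)) idx′)

    B-in-interval {Q} {suc zero} Q<Nb _ _ idx =
      trans (B-interval-start Q<Nb idx)
            (cong (κ * Q +_) (sym (punchIn-< (Admissible.1<p (Placed.admissible (known Q<Nb))))))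
    B-in-interval {Q} {suc (suc s)} Q<Nb _ ss≤K idx =
      B-in-interval-suc Q<Nb (s≤s z≤n) (<⇒≤ ss≤K) idx
        (B-in-interval Q<Nb (s≤s z≤n) (<⇒≤ ss≤K) (≤-trans (+-monoʳ-≤ (Q * K) (n≤1+n (suc s))) idx))

  module NextOffset (N : ℕ) (known : ∀ {M} → M < suc N → Placed M) where
    open KnownOffsets known

    Q R : ℕ
    Q = suc N / τ
    R = suc N % τ

    sucN≡R+Q*τ : suc N ≡ R + Q * τ
    sucN≡R+Q*τ = m≡m%n+[m/n]*n (suc N) τ

    R<τ : R < τ
    R<τ = m%n<n (suc N) τ

    Q<sucN : Q < suc N
    Q<sucN = m/n<m (suc N) τ (≤-trans 2≤k k≤τ)

    o : ℕ
    o = offset Q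

    open Admissible (Placed.admissible (known Q<sucN))

    position : Fin k → ℕ
    position j = R * k + suc (toℕ j)

    position≤ : ∀ j → position j ≤ R * k + k
    position≤ j = +-monoʳ-≤ (R * k) (toℕ<n j)

    R*k+k≤K : R * k + k ≤ K
    R*k+k≤K = begin
      R * k + k  ≡⟨ +-comm (R * k) k ⟩
      suc R * k  ≤⟨ *-monoˡ-≤ k R<τ ⟩
      τ * k      ≡⟨ *-comm τ k ⟩
      K          ∎
      where open ≤-Reasoning

    B-block : ∀ j → B (suc N * k + suc (toℕ j)) ≡ κ * Q + punchIn o (position j)
    B-block j = trans (cong B index≡)
      (B-in-interval Q<sucN (≤-trans (s≤s z≤n) (m≤n+m _ (R * k))) (≤-trans (position≤ j) R*k+k≤K) idx)
      where
      regroup : ∀ R Q τ k x → (R + Q * τ) * k + x ≡ Q * (k * τ) + (R * k + x)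
      regroup = solve-∀
      index≡ : suc N * k + suc (toℕ j) ≡ Q * K + position j
      index≡ = trans (cong (λ n → n * k + suc (toℕ j)) sucN≡R+Q*τ) (regroup R Q τ k (suc (toℕ j)))
      idx : Q * K + position j ≤ suc (suc N) * k
      idx = subst (_≤ suc (suc N) * k) index≡
              (≤-trans (+-monoʳ-≤ (suc N * k) (toℕ<n j)) (≤-reflexive (+-comm (suc N * k) k)))

    E : ℕ
    E = sumFin k (λ j → a j * ⟦ o ≤ position j ⟧)

    A-next≡sum : A (suc (suc N)) ≡ τ * (κ * Q + R * k) + P + E
    A-next≡sum = begin
      A (suc (suc N))
        ≡⟨ A≡sum (suc (suc N)) (s≤s z≤n) ⟩
      sumFin k (λ j → a j * B (suc N * k + suc (toℕ j)))
        ≡⟨ sumFin-cong k (λ j → cong (a j *_) (B-block j)) ⟩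
      sumFin k (λ j → a j * (κ * Q + punchIn o (position j)))
        ≡⟨ sumFin-cong k (λ j → distribute (a j) (κ * Q) (R * k) (suc (toℕ j)) _) ⟩
      sumFin k (λ j → a j * (κ * Q + R * k) + a j * suc (toℕ j) + a j * ⟦ o ≤ position j ⟧)
        ≡⟨ sumFin-+ k _ _ ⟩
      sumFin k (λ j → a j * (κ * Q + R * k) + a j * suc (toℕ j)) + E
        ≡⟨ cong (_+ E) (sumFin-+ k _ _) ⟩
      sumFin k (λ j → a j * (κ * Q + R * k)) + P + E
        ≡⟨ cong (λ x → x + P + E) (sumFin-*ʳ k a (κ * Q + R * k)) ⟩
      τ * (κ * Q + R * k) + P + E
        ∎
      where
      open ≡-Reasoning
      distribute : ∀ a c r s x → a * (c + (r + s + x)) ≡ a * (c + r) + a * s + a * x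
      distribute = solve-∀

    E≤τ : E ≤ τ
    E≤τ = begin
      E                         ≤⟨ sumFin-mono k (λ j → *-monoʳ-≤ (a j) (⟦≤⟧≤1 o (position j))) ⟩
      sumFin k (λ j → a j * 1)  ≡⟨ sumFin-*ʳ k a 1 ⟩
      τ * 1                     ≡⟨ *-identityʳ τ ⟩
      τ                         ∎
      where open ≤-Reasoning

    E≡0 : R ≡ 0 → E ≡ 0
    E≡0 R≡0 = begin
      E                         ≡⟨ sumFin-cong k (λ j → cong (a j *_) (⟦≤⟧-no (position<o j))) ⟩
      sumFin k (λ j → a j * 0)  ≡⟨ sumFin-*ʳ k a 0 ⟩
      τ * 0                     ≡⟨ *-zeroʳ τ ⟩
      0                         ∎
      where
      open ≡-Reasoning
      position<o : ∀ j → position j < o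
      position<o j = ≤-<-trans (subst (λ r → position j ≤ r * k + k) R≡0 (position≤ j)) lower

    1≤E : suc R ≡ τ → P < τ + k → 1 ≤ E
    1≤E sucR≡τ P<τ+k = begin
      1                     ≡⟨ sym (⟦≤⟧-yes (subst (o ≤_) K≡R*k+k (short P<τ+k))) ⟩
      ⟦ o ≤ R * k + k ⟧     ≤⟨ sumFin-last k a (λ t → ⟦ o ≤ R * k + t ⟧) 1≤a 1≤k ⟩
      E                     ∎
      where
      open ≤-Reasoning
      K≡R*k+k : K ≡ R * k + k
      K≡R*k+k = trans (*-comm k τ) (trans (cong (_* k) (sym sucR≡τ)) (+-comm k (R * k)))

    p : ℕ
    p = P + E ∸ R

    R+p≡P+E : R + p ≡ P + E
    R+p≡P+E = m+[n∸m]≡n (≤-trans (<⇒≤ R<τ) (≤-trans τ≤P (m≤m+n P E)))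

    A-next≡κ*sucN+p : A (suc (suc N)) ≡ κ * suc N + p
    A-next≡κ*sucN+p = begin
      A (suc (suc N))                ≡⟨ A-next≡sum ⟩
      τ * (κ * Q + R * k) + P + E    ≡⟨ +-assoc (τ * (κ * Q + R * k)) P E ⟩
      τ * (κ * Q + R * k) + (P + E)  ≡⟨ cong (τ * (κ * Q + R * k) +_) (sym R+p≡P+E) ⟩
      τ * (κ * Q + R * k) + (R + p)  ≡⟨ regroup k τ Q R p ⟩
      κ * (R + Q * τ) + p            ≡⟨ cong (λ n → κ * n + p) (sym sucN≡R+Q*τ) ⟩
      κ * suc N + p                  ∎
      where
      open ≡-Reasoning
      regroup : ∀ k τ Q R p → τ * ((k * τ + 1) * Q + R * k) + (R + p) ≡ (k * τ + 1) * (R + Q * τ) + p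
      regroup = solve-∀

    placed-suc : Placed (suc N)
    placed-suc = placed A-next≡κ*sucN+p (next-offset-admissible R R<τ R+p≡P+E E≤τ E≡0 1≤E)

  placed-all : ∀ M → Placed M
  placed-all = <-rec Placed step
    where
    step : ∀ M → (∀ {M′} → M′ < M → Placed M′) → Placed M
    step zero    _     = placed-zero
    step (suc N) known = NextOffset.placed-suc N known

  A-in-interval : ∀ N → InInterval (κ * N + 1) (κ * suc N) (A (suc N))
  A-in-interval N = subst (InInterval (κ * N + 1) (κ * suc N)) (sym A-suc≡)
    (+-monoʳ-≤ (κ * N) (<⇒≤ 1<p) , κ*N+≤κ*sucN N upper)
    where
    open Placed (placed-all N)
    open Admissible admissible

  initial-block-values : ∀ N j → 1 ≤ j → j ≤ k → B (N * τ * k + j) ≡ κ * N + j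
  initial-block-values N j 1≤j j≤k = begin
    B (N * τ * k + j)             ≡⟨ cong (λ i → B (i + j)) N*τ*k≡N*K ⟩
    B (N * K + j)                 ≡⟨ B-in-interval (s≤s (m≤m*n N τ)) 1≤j (≤-trans j≤k k≤K) idx ⟩
    κ * N + punchIn (offset N) j  ≡⟨ cong (κ * N +_) (punchIn-< (≤-<-trans j≤k lower)) ⟩
    κ * N + j                     ∎
    where
    open ≡-Reasoning
    open KnownOffsets {suc (N * τ)} (λ {M} _ → placed-all M)
    open Admissible (Placed.admissible (placed-all N))
    N*τ*k≡N*K : N * τ * k ≡ N * K
    N*τ*k≡N*K = trans (*-assoc N τ k) (cong (N *_) (*-comm τ k))
    idx : N * K + j ≤ suc (suc (N * τ)) * k
    idx = ≤-trans (+-monoʳ-≤ (N * K) j≤k)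
          (≤-trans (≤-reflexive (trans (cong (_+ k) (sym N*τ*k≡N*K)) (+-comm (N * τ * k) k)))
                   (m≤n+m (suc (N * τ) * k) k))

lemma11 : (k : ℕ) → 2 ≤ k → (a : Fin k → ℕ) → (∀ j → 1 ≤ a j) →
          (A B : ℕ → ℕ) → IsAntiRecurrence k a A B →
          A 1 ≤ (k ∸ 1) * trace k a + 2 →
          ∀ n → 1 ≤ n →
            InInterval ((k * trace k a + 1) * (n ∸ 1) + 1) ((k * trace k a + 1) * n) (A n) ×
            Σ ℕ (λ m → 1 ≤ m ×
              BlockContained k B m ((k * trace k a + 1) * (n ∸ 1) + 1) ((k * trace k a + 1) * n) ×
              (∀ m′ → 1 ≤ m′ → m′ < m →
                ¬ BlockContained k B m′ ((k * trace k a + 1) * (n ∸ 1) + 1) ((k * trace k a + 1) * n)) ×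
              IsInterval (InBlock k B m))
lemma11 k 2≤k a 1≤a A B AR A₁-bounded (suc N) _ =
    A-in-interval N
  , suc (N * τ) , s≤s z≤n
  , (λ x x∈block → within-I (Equivalence.to (block⇔ x) x∈block))
  , earlier-block-not-contained 1≤k (suc (N * τ)) (initial-block-values N 1 ≤-refl 1≤k)
  , (κ * N + 1 , κ * N + k , block⇔)
  where
  open AntiRecurrence k 2≤k a 1≤a A B AR A₁-bounded
  open Blocks k B↑
  block⇔ : ∀ x → InBlock k B (suc (N * τ)) x ⇔ InInterval (κ * N + 1) (κ * N + k) x
  block⇔ = block-isInterval (suc (N * τ)) (κ * N) (initial-block-values N)
  within-I : ∀ {x} → InInterval (κ * N + 1) (κ * N + k) x → InInterval (κ * N + 1) (κ * suc N) x
  within-I (lo , hi) = lo , ≤-trans hi (κ*N+≤κ*sucN N k≤κ)
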